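{- Let $s>1$ and $t\geq 1$ be integers, and let $G$ be the threshold graph of order $s+t$ realized by the binary code (string) $0^{s}1^{t}$. Then the metric dimension of $G$ is $\beta(G)=s+t-2$.
   Context: Threshold graph realized by a binary code $b=b_1b_2\cdots b_n$ (with $b_1=0$): start with a single vertex $v_1$; for $i\geq 2$ add a vertex $v_i$, which is added as an isolated vertex if $b_i=0$ and as a dominating vertex (adjacent to all previously added vertices) if $b_i=1$. Thus for $i<j$, $v_i\sim v_j$ iff $b_j=1$. The code $0^{s}1^{t}$ means $s$ zeros followed by $t$ ones. For an ordered set $\mathcal{W}=\{w_1,\dots,w_k\}$ of vertices of a connected graph, the representation of a vertex $w$ is $(d(w,w_1),\dots,d(w,w_k))$; $\mathcal{W}$ is a resolving set if all vertices have distinct representations; the metric dimension $\beta(G)$ is the minimum cardinality of a resolving set. -}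

module Defs where

open import Data.Nat using (ℕ; zero; suc; _+_; _<_; _≤_)
open import Data.Bool using (Bool; true; false)
open import Data.Fin using (Fin; toℕ)
open import Data.Fin.Subset using (Subset; _∈_; ∣_∣)
open import Data.Product using (Σ; ∃; _×_)
open import Data.Sum using (_⊎_)
open import Relation.Binary.PropositionalEquality using (_≡_; _≢_)

Graph : ℕ → Set₁
Graph n = Fin n → Fin n → Set

data Walk {n : ℕ} (G : Graph n) : Fin n → Fin n → ℕ → Set where
  here : ∀ {u} → Walk G u u zero
  step : ∀ {u w v k} → G u w → Walk G w v k → Walk G u v (suc k)

Dist : ∀ {n} → Graph n → Fin n → Fin n → ℕ → Set
Dist G u v d = Walk G u v d × (∀ k → Walk G u v k → d ≤ k)

Connected : ∀ {n} → Graph n → Set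
Connected {n} G = ∀ (u v : Fin n) → ∃ λ k → Walk G u v k

Resolving : ∀ {n} → Graph n → Subset n → Set
Resolving {n} G W = ∀ (u v : Fin n) → u ≢ v →
  Σ (Fin n) λ w → w ∈ W × ∃ λ d₁ → ∃ λ d₂ →
    Dist G u w d₁ × Dist G v w d₂ × d₁ ≢ d₂

MetricDimension : ∀ {n} → Graph n → ℕ → Set
MetricDimension {n} G k =
  (Σ (Subset n) λ W → Resolving G W × ∣ W ∣ ≡ k) ×
  (∀ (W : Subset n) → Resolving G W → k ≤ ∣ W ∣)

-- Threshold graph of a binary code b (vertex v_{i+1} is index i):
-- for i < j, v_i ~ v_j iff b_j = 1.
ThresholdGraph : ∀ {n} → (Fin n → Bool) → Graph n
ThresholdGraph b i j =
  (toℕ i < toℕ j × b j ≡ true) ⊎ (toℕ j < toℕ i × b i ≡ true)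

code0s1t : (s t : ℕ) → Fin (s + t) → Bool
code0s1t s t i = s Data.Nat.≤ᵇ toℕ i

-- The code 0^s 1^t gives the complete split graph: the first s vertices are
-- independent, the last t form a clique joined to every vertex. With t ≥ 1 it
-- has diameter 2, so the distance between distinct vertices is 1 or 2
-- according to adjacency. Hence two independent vertices, and likewise two
-- clique vertices, are twins that only they themselves can separate, and a
-- resolving set omits at most one vertex of each class: β ≥ (s-1) + (t-1).
-- Conversely, omitting v₁ and v_{s+1} leaves a resolving set, because v₂
-- (here s > 1 is needed) is at distance 2 from v₁ and 1 from v_{s+1}.
module Submission where

open import Defs
open import Data.Nat using (ℕ; zero; suc; _+_; _∸_; _<_; _≤_; z≤n; s≤s; _<?_)
open import Data.Nat.Properties
  using (≤-antisym; ≤-trans; ≤-reflexive; <⇒≤; <⇒≱; ≰⇒>; <-cmp; m≤m+n; m<m+n; m≤n+m∸n; +-mono-≤; +-suc; ≤⇒≤ᵇ; ≤ᵇ⇒≤)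
open import Data.Bool using (true; _≟_)
open import Data.Bool.Properties using (T-≡)
open import Data.Fin as Fin using (Fin; toℕ; fromℕ<; _↑ˡ_; _↑ʳ_)
open import Data.Fin.Properties
  using (toℕ-injective; toℕ<n; toℕ-fromℕ<; toℕ-↑ˡ; toℕ-↑ʳ; ↑ˡ-injective; ↑ʳ-injective; suc-injective)
open import Data.Fin.Subset using (Subset; inside; outside; ⊤; _∈_; _∉_; ∣_∣)
open import Data.Fin.Subset.Properties using (_∈?_; ∈⊤; ∣⊤∣≡n; drop-there; p⊆q⇒∣p∣≤∣q∣)
open import Data.Vec using ([]; _∷_; _++_; here; there)
import Data.Vec as Vec
open import Data.Product using (∃; _×_; _,_; proj₂)
open import Data.Sum as Sum using (_⊎_; inj₁; inj₂; [_,_])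
open import Function using (_∘_; id)
open import Function.Bundles using (_⇔_; mk⇔; Equivalence)
open import Function.Construct.Composition using (_⇔-∘_)
open import Function.Construct.Symmetry using (⇔-sym)
open import Relation.Nullary using (¬_; yes; no; contradiction)
open import Relation.Nullary.Decidable using (_×-dec_; _⊎-dec_)
open import Relation.Binary.Definitions using (Decidable; tri<; tri≈; tri>)
open import Relation.Binary.PropositionalEquality using (_≡_; _≢_; refl; sym; trans; cong; cong₂; subst)

open Equivalence using (to; from)

Diameter≤2 : ∀ {n} → Graph n → Set
Diameter≤2 {n} G = ∀ (u v : Fin n) → u ≢ v → ¬ G u v → Walk G u v 2

Twins : ∀ {n} → Graph n → Fin n → Fin n → Set
Twins {n} G u v = ∀ (w : Fin n) → u ≢ w → v ≢ w → G u w ⇔ G v w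

Separates : ∀ {n} → Graph n → (w u v : Fin n) → Set
Separates G w u v = ∃ λ d₁ → ∃ λ d₂ → Dist G u w d₁ × Dist G v w d₂ × d₁ ≢ d₂

module _ {n : ℕ} {G : Graph n} where

  walk₀⇒≡ : ∀ {u v} → Walk G u v 0 → u ≡ v
  walk₀⇒≡ here = refl

  walk₁⇒adj : ∀ {u v} → Walk G u v 1 → G u v
  walk₁⇒adj (step e here) = e

  dist-unique : ∀ {u v d₁ d₂} → Dist G u v d₁ → Dist G u v d₂ → d₁ ≡ d₂
  dist-unique (p , p-shortest) (q , q-shortest) = ≤-antisym (p-shortest _ q) (q-shortest _ p)

  dist-self : ∀ {u} → Dist G u u 0
  dist-self = here , λ _ _ → z≤n

  dist≢0 : ∀ {u v d} → u ≢ v → Dist G u v d → d ≢ 0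
  dist≢0 u≢v (p , _) refl = u≢v (walk₀⇒≡ p)

  dist-adj : ∀ {u v} → u ≢ v → G u v → Dist G u v 1
  dist-adj {u} {v} u≢v e = step e here , shortest
    where
    shortest : ∀ k → Walk G u v k → 1 ≤ k
    shortest zero    p = contradiction (walk₀⇒≡ p) u≢v
    shortest (suc k) _ = s≤s z≤n

  dist-nonadj : ∀ {u v} → u ≢ v → ¬ G u v → Walk G u v 2 → Dist G u v 2
  dist-nonadj {u} {v} u≢v ¬e p = p , shortest
    where
    shortest : ∀ k → Walk G u v k → 2 ≤ k
    shortest zero          q = contradiction (walk₀⇒≡ q) u≢v
    shortest (suc zero)    q = contradiction (walk₁⇒adj q) ¬e
    shortest (suc (suc k)) _ = s≤s (s≤s z≤n)

  separates-sym : ∀ {w u v} → Separates G w u v → Separates G w v u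
  separates-sym (d₁ , d₂ , D₁ , D₂ , d₁≢d₂) = d₂ , d₁ , D₂ , D₁ , d₁≢d₂ ∘ sym

  self-separates : ∀ {u v d} → u ≢ v → Dist G v u d → Separates G u u v
  self-separates u≢v D = 0 , _ , dist-self , D , dist≢0 (u≢v ∘ sym) D ∘ sym

module _ {n : ℕ} {G : Graph n} (adj? : Decidable G) (diameter : Diameter≤2 G) where

  dist-exists : ∀ u v → ∃ (Dist G u v)
  dist-exists u v with u Fin.≟ v | adj? u v
  ... | yes refl | _     = 0 , dist-self
  ... | no u≢v   | yes e = 1 , dist-adj u≢v e
  ... | no u≢v   | no ¬e = 2 , dist-nonadj u≢v ¬e (diameter u v u≢v ¬e)

  twins-equidistant : ∀ {u v w d₁ d₂} → Twins G u v → u ≢ w → v ≢ w →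
                      Dist G u w d₁ → Dist G v w d₂ → d₁ ≡ d₂
  twins-equidistant {u} {v} {w} twins u≢w v≢w D₁ D₂ with adj? u w
  ... | yes e = trans (dist-unique D₁ (dist-adj u≢w e))
                      (dist-unique (dist-adj v≢w (to (twins w u≢w v≢w) e)) D₂)
  ... | no ¬e = trans (dist-unique D₁ (dist-nonadj u≢w ¬e (diameter u w u≢w ¬e)))
                      (dist-unique (dist-nonadj v≢w ¬e′ (diameter v w v≢w ¬e′)) D₂)
    where
    ¬e′ : ¬ G v w
    ¬e′ = ¬e ∘ from (twins w u≢w v≢w)

  resolving⇒twin∈ : ∀ {W u v} → Resolving G W → u ≢ v → Twins G u v → u ∈ W ⊎ v ∈ W
  resolving⇒twin∈ {u = u} {v} resolving u≢v twins with resolving u v u≢v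
  ... | w , w∈W , _ , _ , D₁ , D₂ , d₁≢d₂ with u Fin.≟ w | v Fin.≟ w
  ... | yes refl | _        = inj₁ w∈W
  ... | no _     | yes refl = inj₂ w∈W
  ... | no u≢w   | no v≢w   = contradiction (twins-equidistant twins u≢w v≢w D₁ D₂) d₁≢d₂

  resolving-if-missing-pair-separated : ∀ {W a b w} → (∀ x → x ∉ W → x ≡ a ⊎ x ≡ b) →
                                        w ∈ W → Separates G w a b → Resolving G W
  resolving-if-missing-pair-separated {W} {w = w} missing w∈W separated u v u≢v
    with u ∈? W | v ∈? W
  ... | yes u∈W | _       = u , u∈W , self-separates u≢v (proj₂ (dist-exists v u))
  ... | no _    | yes v∈W =
    v , v∈W , separates-sym (self-separates (u≢v ∘ sym) (proj₂ (dist-exists u v)))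
  ... | no u∉W  | no v∉W with missing u u∉W | missing v v∉W
  ... | inj₁ refl | inj₁ refl = contradiction refl u≢v
  ... | inj₁ refl | inj₂ refl = w , w∈W , separated
  ... | inj₂ refl | inj₁ refl = w , w∈W , separates-sym separated
  ... | inj₂ refl | inj₂ refl = contradiction refl u≢v

∣p++q∣≡∣p∣+∣q∣ : ∀ {m n} (p : Subset m) (q : Subset n) → ∣ p ++ q ∣ ≡ ∣ p ∣ + ∣ q ∣
∣p++q∣≡∣p∣+∣q∣ []            q = refl
∣p++q∣≡∣p∣+∣q∣ (inside  ∷ p) q = cong suc (∣p++q∣≡∣p∣+∣q∣ p q)
∣p++q∣≡∣p∣+∣q∣ (outside ∷ p) q = ∣p++q∣≡∣p∣+∣q∣ p q

↑ˡ-∈-++⁻ : ∀ {m n} {p : Subset m} {q : Subset n} i → i ↑ˡ n ∈ p ++ q → i ∈ p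
↑ˡ-∈-++⁻ {p = _ ∷ _} Fin.zero    here      = here
↑ˡ-∈-++⁻ {p = _ ∷ _} (Fin.suc i) (there h) = there (↑ˡ-∈-++⁻ i h)

↑ʳ-∈-++⁻ : ∀ {m n} (p : Subset m) {q : Subset n} j → m ↑ʳ j ∈ p ++ q → j ∈ q
↑ʳ-∈-++⁻ []      j h         = h
↑ʳ-∈-++⁻ (_ ∷ p) j (there h) = ↑ʳ-∈-++⁻ p j h

pair-hitting⇒n∸1≤∣p∣ : ∀ {n} {p : Subset n} → (∀ i j → i ≢ j → i ∈ p ⊎ j ∈ p) → n ∸ 1 ≤ ∣ p ∣
pair-hitting⇒n∸1≤∣p∣ {p = []} _ = z≤n
pair-hitting⇒n∸1≤∣p∣ {suc n} {inside ∷ p} hitting =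
  ≤-trans (m≤n+m∸n n 1) (s≤s (pair-hitting⇒n∸1≤∣p∣ hitting-tail))
  where
  hitting-tail : ∀ i j → i ≢ j → i ∈ p ⊎ j ∈ p
  hitting-tail i j i≢j = Sum.map drop-there drop-there (hitting (Fin.suc i) (Fin.suc j) (i≢j ∘ suc-injective))
pair-hitting⇒n∸1≤∣p∣ {suc n} {outside ∷ p} hitting =
  subst (_≤ ∣ p ∣) (∣⊤∣≡n n) (p⊆q⇒∣p∣≤∣q∣ ⊤⊆p)
  where
  ⊤⊆p : ∀ {x} → x ∈ ⊤ → x ∈ p
  ⊤⊆p {x} _ = [ (λ ()) , drop-there ] (hitting Fin.zero (Fin.suc x) (λ ()))

module CompleteSplit (s t : ℕ) where

  G : Graph (s + t)
  G = ThresholdGraph (code0s1t s t)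

  Dominating : Fin (s + t) → Set
  Dominating i = s ≤ toℕ i

  Independent : Fin (s + t) → Set
  Independent i = toℕ i < s

  dominating⇒code : ∀ {i} → Dominating i → code0s1t s t i ≡ true
  dominating⇒code = to T-≡ ∘ ≤⇒≤ᵇ

  code⇒dominating : ∀ {i} → code0s1t s t i ≡ true → Dominating i
  code⇒dominating {i} = ≤ᵇ⇒≤ s (toℕ i) ∘ from T-≡

  ↑ˡ-independent : ∀ i → Independent (i ↑ˡ t)
  ↑ˡ-independent i = subst (_< s) (sym (toℕ-↑ˡ i t)) (toℕ<n i)

  ↑ʳ-dominating : ∀ j → Dominating (s ↑ʳ j)
  ↑ʳ-dominating j = subst (s ≤_) (sym (toℕ-↑ʳ s j)) (m≤m+n s (toℕ j))

  adj? : Decidable G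
  adj? i j = ((toℕ i <? toℕ j) ×-dec (code0s1t s t j ≟ true))
       ⊎-dec ((toℕ j <? toℕ i) ×-dec (code0s1t s t i ≟ true))

  adj-sym : ∀ {i j} → G i j → G j i
  adj-sym = Sum.swap

  adj⇒dominating : ∀ {i j} → G i j → Dominating i ⊎ Dominating j
  adj⇒dominating (inj₁ (_ , e)) = inj₂ (code⇒dominating e)
  adj⇒dominating (inj₂ (_ , e)) = inj₁ (code⇒dominating e)

  dominating-adj : ∀ {i j} → i ≢ j → Dominating j → G i j
  dominating-adj {i} {j} i≢j dj with <-cmp (toℕ i) (toℕ j)
  ... | tri< i<j _ _ = inj₁ (i<j , dominating⇒code dj)
  ... | tri≈ _ i≡j _ = contradiction (toℕ-injective i≡j) i≢j
  ... | tri> _ _ j<i = inj₂ (j<i , dominating⇒code (≤-trans dj (<⇒≤ j<i)))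

  independent-adj⇔ : ∀ {i j} → Independent i → i ≢ j → G i j ⇔ Dominating j
  independent-adj⇔ ii i≢j =
    mk⇔ ([ (λ di → contradiction di (<⇒≱ ii)) , id ] ∘ adj⇒dominating) (dominating-adj i≢j)

  nonadj⇒independent : ∀ {i j} → i ≢ j → ¬ G i j → Independent i
  nonadj⇒independent i≢j ¬e = ≰⇒> (¬e ∘ adj-sym ∘ dominating-adj (i≢j ∘ sym))

  diameter≤2 : 1 ≤ t → Diameter≤2 G
  diameter≤2 1≤t u v u≢v ¬e =
    step (dominating-adj u≢c dc) (step (adj-sym (dominating-adj v≢c dc)) here)
    where
    s<s+t = m<m+n s 1≤t
    c = fromℕ< s<s+t
    dc : Dominating c
    dc = ≤-reflexive (sym (toℕ-fromℕ< s<s+t))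
    u≢c : u ≢ c
    u≢c refl = <⇒≱ (nonadj⇒independent u≢v ¬e) dc
    v≢c : v ≢ c
    v≢c refl = <⇒≱ (nonadj⇒independent (u≢v ∘ sym) (¬e ∘ adj-sym)) dc

  independent-twins : ∀ {u v} → Independent u → Independent v → Twins G u v
  independent-twins iu iv w u≢w v≢w = ⇔-sym (independent-adj⇔ iv v≢w) ⇔-∘ independent-adj⇔ iu u≢w

  dominating-twins : ∀ {u v} → Dominating u → Dominating v → Twins G u v
  dominating-twins du dv w u≢w v≢w =
    mk⇔ (λ _ → adj-sym (dominating-adj (v≢w ∘ sym) dv)) (λ _ → adj-sym (dominating-adj (u≢w ∘ sym) du))

  resolving⇒size≥ : 1 ≤ t → ∀ W → Resolving G W → (s ∸ 1) + (t ∸ 1) ≤ ∣ W ∣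
  resolving⇒size≥ 1≤t W resolving with Vec.splitAt s W
  ... | p , q , refl =
    subst ((s ∸ 1) + (t ∸ 1) ≤_) (sym (∣p++q∣≡∣p∣+∣q∣ p q))
      (+-mono-≤ (pair-hitting⇒n∸1≤∣p∣ hitting-p) (pair-hitting⇒n∸1≤∣p∣ hitting-q))
    where
    twin∈ : ∀ {u v} → u ≢ v → Twins G u v → u ∈ p ++ q ⊎ v ∈ p ++ q
    twin∈ = resolving⇒twin∈ adj? (diameter≤2 1≤t) resolving
    hitting-p : ∀ i j → i ≢ j → i ∈ p ⊎ j ∈ p
    hitting-p i j i≢j = Sum.map (↑ˡ-∈-++⁻ i) (↑ˡ-∈-++⁻ j)
      (twin∈ (i≢j ∘ ↑ˡ-injective t i j) (independent-twins (↑ˡ-independent i) (↑ˡ-independent j)))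
    hitting-q : ∀ i j → i ≢ j → i ∈ q ⊎ j ∈ q
    hitting-q i j i≢j = Sum.map (↑ʳ-∈-++⁻ p i) (↑ʳ-∈-++⁻ p j)
      (twin∈ (i≢j ∘ ↑ʳ-injective s i j) (dominating-twins (↑ʳ-dominating i) (↑ʳ-dominating j)))

∉⊤++outside∷⊤ : ∀ {m n} {x : Fin (m + suc n)} → x ∉ ⊤ {m} ++ (outside ∷ ⊤ {n}) → x ≡ m ↑ʳ Fin.zero
∉⊤++outside∷⊤ {zero}  {x = Fin.zero}  _   = refl
∉⊤++outside∷⊤ {zero}  {x = Fin.suc x} x∉ = contradiction (there ∈⊤) x∉
∉⊤++outside∷⊤ {suc m} {x = Fin.zero}  x∉ = contradiction here x∉
∉⊤++outside∷⊤ {suc m} {x = Fin.suc x} x∉ = cong Fin.suc (∉⊤++outside∷⊤ (x∉ ∘ there))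

module OmitFirstOfEachClass (s t : ℕ) where

  open CompleteSplit (2 + s) (1 + t)

  W : Subset (2 + s + (1 + t))
  W = (outside ∷ ⊤ {suc s}) ++ (outside ∷ ⊤ {t})

  ∣W∣≡ : ∣ W ∣ ≡ s + suc t
  ∣W∣≡ = trans (∣p++q∣≡∣p∣+∣q∣ (⊤ {suc s}) (outside ∷ ⊤ {t}))
               (trans (cong₂ _+_ (∣⊤∣≡n (suc s)) (∣⊤∣≡n t)) (sym (+-suc s t)))

  first-clique-vertex : Fin (2 + s + (1 + t))
  first-clique-vertex = (2 + s) ↑ʳ Fin.zero

  missing : ∀ x → x ∉ W → x ≡ Fin.zero ⊎ x ≡ first-clique-vertex
  missing Fin.zero    _  = inj₁ refl
  missing (Fin.suc x) x∉ = inj₂ (cong Fin.suc (∉⊤++outside∷⊤ (x∉ ∘ there)))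

  second-separates : Separates G (Fin.suc Fin.zero) Fin.zero first-clique-vertex
  second-separates = 2 , 1 , dist-nonadj (λ ()) ¬adj (diameter≤2 (s≤s z≤n) _ _ (λ ()) ¬adj)
                   , dist-adj (λ ()) (adj-sym (dominating-adj (λ ()) (↑ʳ-dominating Fin.zero)))
                   , λ ()
    where
    ¬adj : ¬ G Fin.zero (Fin.suc Fin.zero)
    ¬adj e with to (independent-adj⇔ (s≤s z≤n) (λ ())) e
    ... | s≤s ()

  W-resolving : Resolving G W
  W-resolving = resolving-if-missing-pair-separated adj? (diameter≤2 (s≤s z≤n))
                  missing (there here) second-separates

lemma2p3 : (s t : ℕ) → 1 < s → 1 ≤ t →
    MetricDimension (ThresholdGraph (code0s1t s t)) (s + t ∸ 2)
lemma2p3 zero          _       ()        _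
lemma2p3 (suc zero)    _       (s≤s ()) _
lemma2p3 (suc (suc s)) zero    _        ()
lemma2p3 (suc (suc s)) (suc t) _ _ =
  (W , W-resolving , ∣W∣≡) ,
  λ W′ resolving → subst (_≤ ∣ W′ ∣) (sym (+-suc s t)) (resolving⇒size≥ (s≤s z≤n) W′ resolving)
  where
  open OmitFirstOfEachClass s t
  open CompleteSplit (2 + s) (1 + t)
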